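{- Let $f:\mathbb{N}^2\to\mathbb{N}$, and write $f(n,\mathbb{N}):=\{f(n,k)\mid k\in\mathbb{N}\}$ and $f(\mathbb{N},n):=\{f(k,n)\mid k\in\mathbb{N}\}$. The following are equivalent: (1) there exists $C\subseteq\mathbb{N}$ such that for all $n\in\mathbb{N}$, $f(n,\mathbb{N})\cap C\neq\emptyset$ and $f(\mathbb{N},n)\cap(\mathbb{N}\setminus C)\neq\emptyset$; (2) there exist disjoint $A,B\subseteq\mathbb{N}$ such that for all $n\in\mathbb{N}$: ($f(n,\mathbb{N})\cap A\neq\emptyset$ or $f(n,\mathbb{N})\setminus(A\cup B)$ is infinite) and ($f(\mathbb{N},n)\cap B\neq\emptyset$ or $f(\mathbb{N},n)\setminus(A\cup B)$ is infinite). -}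

module Defs where

open import Data.Nat using (ℕ; _≥_)
open import Data.Bool using (Bool; T; _∨_)
open import Data.Product using (Σ; ∃; ∃-syntax; _×_)
open import Data.Empty using (⊥)
open import Relation.Nullary using (¬_)

Subset : Set
Subset = ℕ → Bool

_∈_ : ℕ → Subset → Set
x ∈ S = T (S x)

_∉_ : ℕ → Subset → Set
x ∉ S = ¬ (x ∈ S)

Disjoint : Subset → Subset → Set
Disjoint A B = ∀ x → ¬ (x ∈ A × x ∈ B)

_∪_ : Subset → Subset → Subset
(A ∪ B) x = A x ∨ B x

RowMeets : (ℕ → ℕ → ℕ) → ℕ → Subset → Set
RowMeets f n S = ∃[ k ] (f n k ∈ S)

ColMeets : (ℕ → ℕ → ℕ) → ℕ → Subset → Set
ColMeets f n S = ∃[ k ] (f k n ∈ S)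

ColMeetsCompl : (ℕ → ℕ → ℕ) → ℕ → Subset → Set
ColMeetsCompl f n S = ∃[ k ] (f k n ∉ S)

RowOutsideInfinite : (ℕ → ℕ → ℕ) → ℕ → Subset → Set
RowOutsideInfinite f n S = ∀ m → ∃[ k ] (f n k ≥ m × f n k ∉ S)

ColOutsideInfinite : (ℕ → ℕ → ℕ) → ℕ → Subset → Set
ColOutsideInfinite f n S = ∀ m → ∃[ k ] (f k n ≥ m × f k n ∉ S)

-- (1) ⇒ (2) takes A := C and B := ℕ ∖ C.  For (2) ⇒ (1) put C := A ∪ R, where R
-- holds one point outside A ∪ B of every row that misses A.  Such points must
-- be kept away from the points outside A ∪ B chosen for the columns that miss
-- B; this is achieved by choosing them in stages, the row-n point and then the
-- column-n point each lying above everything chosen before.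
module Submission where

open import Defs
open import Data.Nat using (ℕ; zero; suc; _≤_; _<_; _⊔_; z≤n; s≤s)
open import Data.Nat.Properties
open import Data.Bool using (true; false; not)
open import Data.Bool.Properties using (T-∨)
open import Data.Maybe using (Maybe; just; nothing)
open import Data.Maybe.Properties using (≡-dec)
open import Data.Product using (∃-syntax; _×_; _,_; proj₁; proj₂)
open import Data.Sum using (_⊎_; inj₁; inj₂; [_,_]; map₂)
open import Data.Empty using (⊥)
open import Data.Unit using (tt)
open import Relation.Nullary using (Dec)
open import Relation.Nullary.Decidable using (map′; isYes; toWitness; fromWitness)
open import Relation.Binary.PropositionalEquality using (_≡_; refl)
open import Function.Base using (_∘_)
open import Function.Bundles using (_⇔_; mk⇔; Equivalence)

∈-∪⁺ˡ : ∀ {x} A B → x ∈ A → x ∈ (A ∪ B)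
∈-∪⁺ˡ A B x∈A = Equivalence.from T-∨ (inj₁ x∈A)

∈-∪⁺ʳ : ∀ {x} A B → x ∈ B → x ∈ (A ∪ B)
∈-∪⁺ʳ A B x∈B = Equivalence.from T-∨ (inj₂ x∈B)

∈-∪⁻ : ∀ {x} A B → x ∈ (A ∪ B) → x ∈ A ⊎ x ∈ B
∈-∪⁻ A B = Equivalence.to T-∨

∁ : Subset → Subset
∁ S x = not (S x)

∉⇒∈∁ : ∀ {x} S → x ∉ S → x ∈ ∁ S
∉⇒∈∁ {x} S x∉S with S x
... | true  = x∉S tt
... | false = tt

disjoint-∁ : ∀ S → Disjoint S (∁ S)
disjoint-∁ S x _ with S x
disjoint-∁ S x (_ , ()) | true
disjoint-∁ S x (() , _) | false

Unbounded : (ℕ → Set) → Set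
Unbounded P = ∀ m → ∃[ x ] (m ≤ x × P x)

≤-stepwise-mono : (g : ℕ → ℕ) → (∀ n → g n ≤ g (suc n)) → ∀ {i j} → i ≤ j → g i ≤ g j
≤-stepwise-mono g step {j = zero} z≤n = ≤-refl
≤-stepwise-mono g step {i} {suc j} i≤1+j with m≤n⇒m<n∨m≡n i≤1+j
... | inj₁ (s≤s i≤j) = ≤-trans (≤-stepwise-mono g step i≤j) (step j)
... | inj₂ refl      = ≤-refl

<-stepwise⇒id≤ : (g : ℕ → ℕ) → (∀ n → g n < g (suc n)) → ∀ n → n ≤ g n
<-stepwise⇒id≤ g step zero    = z≤n
<-stepwise⇒id≤ g step (suc n) = ≤-trans (s≤s (<-stepwise⇒id≤ g step n)) (step n)

-- The image of a partial sequence s is decidable once s i ≥ i: only i ≤ x can hit x.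
image? : (s : ℕ → Maybe ℕ) → (∀ {i x} → s i ≡ just x → i ≤ x) →
         ∀ x → Dec (∃[ i ] s i ≡ just x)
image? s s≥id x =
  map′ (λ (i , _ , eq) → i , eq) (λ (i , eq) → i , s≤s (s≥id eq) , eq)
       (anyUpTo? (λ i → ≡-dec _≟_ (s i) (just x)) (suc x))

pickAbove : ∀ {Z : Set} {P : ℕ → Set} → Z ⊎ Unbounded P → ℕ → Maybe ℕ
pickAbove (inj₁ _) m = nothing
pickAbove (inj₂ u) m = just (proj₁ (u m))

pickAbove-sound : ∀ {Z : Set} {P : ℕ → Set} (s : Z ⊎ Unbounded P) {m x} →
                  pickAbove s m ≡ just x → m ≤ x × P x
pickAbove-sound (inj₂ u) {m} refl = proj₂ (u m)

pickAbove-defined : ∀ {Z : Set} {P : ℕ → Set} (s : Z ⊎ Unbounded P) m →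
                    Z ⊎ ∃[ x ] pickAbove s m ≡ just x
pickAbove-defined (inj₁ z) m = inj₁ z
pickAbove-defined (inj₂ u) m = inj₂ (_ , refl)

above : Maybe ℕ → ℕ
above nothing  = 0
above (just x) = suc x

x<above : ∀ {m x} → m ≡ just x → x < above m
x<above refl = ≤-refl

module Separation {X Y : ℕ → Set} {U V : ℕ → ℕ → Set}
  (rows : ∀ n → X n ⊎ Unbounded (U n)) (cols : ∀ n → Y n ⊎ Unbounded (V n)) where

  -- Stage n is the interval [start n, start (suc n)): the row-n point lies in
  -- [start n, middle n) and the column-n point in [middle n, start (suc n)).
  start middle : ℕ → ℕ
  rowPoint colPoint : ℕ → Maybe ℕ

  start zero    = 0
  start (suc n) = suc (middle n ⊔ above (colPoint n))
  middle n      = start n ⊔ above (rowPoint n)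
  rowPoint n    = pickAbove (rows n) (start n)
  colPoint n    = pickAbove (cols n) (middle n)

  start≤middle : ∀ n → start n ≤ middle n
  start≤middle n = m≤m⊔n (start n) _

  middle<start : ∀ n → middle n < start (suc n)
  middle<start n = s≤s (m≤m⊔n (middle n) _)

  start-mono : ∀ {i j} → i ≤ j → start i ≤ start j
  start-mono = ≤-stepwise-mono start (λ n → ≤-trans (start≤middle n) (<⇒≤ (middle<start n)))

  middle-mono : ∀ {i j} → i ≤ j → middle i ≤ middle j
  middle-mono = ≤-stepwise-mono middle (λ n → ≤-trans (<⇒≤ (middle<start n)) (start≤middle (suc n)))

  rowPoint-bounds : ∀ {n x} → rowPoint n ≡ just x → start n ≤ x × x < middle n
  rowPoint-bounds {n} eq =
    proj₁ (pickAbove-sound (rows n) eq) , ≤-trans (x<above eq) (m≤n⊔m (start n) _)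

  colPoint-bounds : ∀ {n x} → colPoint n ≡ just x → middle n ≤ x × x < start (suc n)
  colPoint-bounds {n} eq =
    proj₁ (pickAbove-sound (cols n) eq) , m<n⇒m<1+n (≤-trans (x<above eq) (m≤n⊔m (middle n) _))

  rowPoint≢colPoint : ∀ {i n x} → rowPoint i ≡ just x → colPoint n ≡ just x → ⊥
  rowPoint≢colPoint {i} {n} r c with ≤-<-connex i n
  ... | inj₁ i≤n = <-irrefl refl
    (≤-trans (proj₂ (rowPoint-bounds r)) (≤-trans (middle-mono i≤n) (proj₁ (colPoint-bounds c))))
  ... | inj₂ n<i = <-irrefl refl
    (≤-trans (proj₂ (colPoint-bounds c)) (≤-trans (start-mono n<i) (proj₁ (rowPoint-bounds r))))

  rowPoint≥index : ∀ {i x} → rowPoint i ≡ just x → i ≤ x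
  rowPoint≥index {i} eq = ≤-trans (<-stepwise⇒id≤ start start<start i) (proj₁ (rowPoint-bounds eq))
    where
    start<start : ∀ n → start n < start (suc n)
    start<start n = ≤-<-trans (start≤middle n) (middle<start n)

  R : Subset
  R x = isYes (image? rowPoint rowPoint≥index x)

  ∈R⇒rowPoint : ∀ {x} → x ∈ R → ∃[ i ] rowPoint i ≡ just x
  ∈R⇒rowPoint {x} = toWitness {a? = image? rowPoint rowPoint≥index x}

  rowPoint⇒∈R : ∀ {i x} → rowPoint i ≡ just x → x ∈ R
  rowPoint⇒∈R {i} {x} eq = fromWitness {a? = image? rowPoint rowPoint≥index x} (i , eq)

  R-meets-rows : ∀ n → X n ⊎ ∃[ x ] (x ∈ R × U n x)
  R-meets-rows n = map₂ (λ (x , eq) → x , rowPoint⇒∈R eq , proj₂ (pickAbove-sound (rows n) eq))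
                        (pickAbove-defined (rows n) (start n))

  cols-avoid-R : ∀ n → Y n ⊎ ∃[ x ] (x ∉ R × V n x)
  cols-avoid-R n = map₂ (λ (x , eq) → x , (λ x∈R → rowPoint≢colPoint (proj₂ (∈R⇒rowPoint x∈R)) eq)
                                        , proj₂ (pickAbove-sound (cols n) eq))
                        (pickAbove-defined (cols n) (middle n))

  R⊆⋃U : ∀ x → x ∈ R → ∃[ n ] U n x
  R⊆⋃U x x∈R = let (i , eq) = ∈R⇒rowPoint x∈R in i , proj₂ (pickAbove-sound (rows i) eq)

separating-set : ∀ {X Y : ℕ → Set} {U V : ℕ → ℕ → Set} →
  (∀ n → X n ⊎ Unbounded (U n)) → (∀ n → Y n ⊎ Unbounded (V n)) →
  ∃[ R ] ((∀ n → X n ⊎ ∃[ x ] (x ∈ R × U n x))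
        × (∀ n → Y n ⊎ ∃[ x ] (x ∉ R × V n x))
        × (∀ x → x ∈ R → ∃[ n ] U n x))
separating-set rows cols = R , R-meets-rows , cols-avoid-R , R⊆⋃U
  where open Separation rows cols

RowPointOutside ColPointOutside : (ℕ → ℕ → ℕ) → Subset → ℕ → ℕ → Set
RowPointOutside f S n x = x ∉ S × ∃[ k ] f n k ≡ x
ColPointOutside f S n x = x ∉ S × ∃[ k ] f k n ≡ x

RowOutsideInfinite⇒Unbounded : ∀ f S n → RowOutsideInfinite f n S → Unbounded (RowPointOutside f S n)
RowOutsideInfinite⇒Unbounded f S n h m = let (k , m≤ , ∉S) = h m in f n k , m≤ , ∉S , k , refl

ColOutsideInfinite⇒Unbounded : ∀ f S n → ColOutsideInfinite f n S → Unbounded (ColPointOutside f S n)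
ColOutsideInfinite⇒Unbounded f S n h m = let (k , m≤ , ∉S) = h m in f k n , m≤ , ∉S , k , refl

ColMeetsCompl⇒ColMeets∁ : ∀ f n C → ColMeetsCompl f n C → ColMeets f n (∁ C)
ColMeetsCompl⇒ColMeets∁ f n C (k , fkn∉C) = k , ∉⇒∈∁ C fkn∉C

splits-from-disjoint : ∀ f A B → Disjoint A B →
  (∀ n → (RowMeets f n A ⊎ RowOutsideInfinite f n (A ∪ B))
       × (ColMeets f n B ⊎ ColOutsideInfinite f n (A ∪ B))) →
  ∃[ C ] (∀ n → RowMeets f n C × ColMeetsCompl f n C)
splits-from-disjoint f A B A∩B=∅ h
  with separating-set {U = RowPointOutside f (A ∪ B)} {V = ColPointOutside f (A ∪ B)}
         (λ n → map₂ (RowOutsideInfinite⇒Unbounded f (A ∪ B) n) (proj₁ (h n)))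
         (λ n → map₂ (ColOutsideInfinite⇒Unbounded f (A ∪ B) n) (proj₂ (h n)))
... | R , R-meets-rows , cols-avoid-R , R⊆⋃U = A ∪ R , λ n → row n , col n
  where
  row : ∀ n → RowMeets f n (A ∪ R)
  row n with R-meets-rows n
  ... | inj₁ (k , fnk∈A)              = k , ∈-∪⁺ˡ A R fnk∈A
  ... | inj₂ (_ , x∈R , _ , k , refl) = k , ∈-∪⁺ʳ A R x∈R

  col : ∀ n → ColMeetsCompl f n (A ∪ R)
  col n with cols-avoid-R n
  ... | inj₁ (k , fkn∈B) = k , [ (λ fkn∈A → A∩B=∅ _ (fkn∈A , fkn∈B))
                               , (λ fkn∈R → proj₁ (proj₂ (R⊆⋃U _ fkn∈R)) (∈-∪⁺ʳ A B fkn∈B)) ]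
                               ∘ ∈-∪⁻ A R
  ... | inj₂ (_ , x∉R , x∉A∪B , k , refl) = k , [ x∉A∪B ∘ ∈-∪⁺ˡ A B , x∉R ] ∘ ∈-∪⁻ A R

lemma2p6 : (f : ℕ → ℕ → ℕ) →
    (∃[ C ] (∀ n → RowMeets f n C × ColMeetsCompl f n C))
    ⇔
    (∃[ A ] ∃[ B ] (Disjoint A B ×
    (∀ n → (RowMeets f n A ⊎ RowOutsideInfinite f n (A ∪ B))
    × (ColMeets f n B ⊎ ColOutsideInfinite f n (A ∪ B)))))
lemma2p6 f = mk⇔
  (λ (C , h) → C , ∁ C , disjoint-∁ C ,
     λ n → inj₁ (proj₁ (h n)) , inj₁ (ColMeetsCompl⇒ColMeets∁ f n C (proj₂ (h n))))
  (λ (A , B , A∩B=∅ , h) → splits-from-disjoint f A B A∩B=∅ h)
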